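{- Let $t$ be a positive integer, $\mu$ a $t$-core partition and $1\le k\le t-1$. Then $|\mu(0)|=0$ and $$|\mu(k)|+|\mu(t-k)|=\sum_{(i,j)\in B_k}\binom{d_i-d_j}{2}.$$
   Context: Hook length of a box: boxes to its right in its row, plus below it in its column, plus one; $\mathcal H(\mu)$ is the multiset of hook lengths; a $t$-core has no hook length divisible by $t$. For $0\le k\le t-1$, $\mu(k)=\{h\in\mathcal H(\mu): h\equiv k\pmod t\}$ as a multiset. The 01-sequence $(z_{\mu,j})_{j\in\mathbb Z}$: traverse the boundary of the Young diagram from the bottom (infinite vertical ray below the first column) to the right (infinite horizontal ray right of the first row), labelling vertical edges $0$ and horizontal edges $1$, indexed so that $\#\{j\ge0:z_{\mu,j}=0\}=\#\{j<0:z_{\mu,j}=1\}$. For $0\le i\le t-1$, $b_i=\min\{j: j\equiv i\pmod t,\ z_{\mu,j}=1\}$ and $d_i$ is defined by $b_i=td_i+i$. $B_k=\{(i,i+k):0\le i\le t-1-k\}\cup\{(i,i+t-k):0\le i\le k-1\}$ as a multiset (if $k=t-k$, repeated pairs are kept twice). $\binom{a}{2}=a(a-1)/2$ for every integer $a$. -}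

module Defs where

open import Data.Nat as ℕ using (ℕ; zero; suc; _∸_; _<_; _≤_; _≥_; NonZero)
open import Data.Nat.Divisibility using (_∣_)
open import Data.Nat.DivMod using (_%_)
open import Data.Integer as ℤ using (ℤ; +_; -[1+_])
open import Data.Integer.DivMod using (_/ℕ_)
open import Data.Bool using (Bool; true; false)
open import Data.List using (List; []; _∷_; _++_; [_]; replicate; map; concat; upTo; length; filter; sum)
open import Data.List.Relation.Unary.All using (All)
open import Data.Product using (_×_; _,_)
open import Relation.Binary.PropositionalEquality using (_≡_)
open import Relation.Nullary using (¬_)
import Data.Nat.Properties as ℕP

data Decreasing : List ℕ → Set where
  dec-nil  : Decreasing []
  dec-one  : ∀ {x} → Decreasing (x ∷ [])
  dec-cons : ∀ {x y xs} → y ≤ x → Decreasing (y ∷ xs) → Decreasing (x ∷ y ∷ xs)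

IsPartition : List ℕ → Set
IsPartition λs = Decreasing λs × All (λ x → 1 ≤ x) λs

rowsLongerThan : ℕ → List ℕ → ℕ
rowsLongerThan c [] = 0
rowsLongerThan c (x ∷ xs) with c ℕP.<? x
... | Relation.Nullary.yes _ = suc (rowsLongerThan c xs)
... | Relation.Nullary.no  _ = rowsLongerThan c xs

-- Hook lengths of the boxes of one row (length x, column index c = 0..x-1),
-- 'below' being the list of rows below it:
-- hook = (boxes to the right) + (boxes below in the column) + 1.
rowHooks : ℕ → List ℕ → List ℕ
rowHooks x below = map (λ c → (x ∸ suc c) ℕ.+ rowsLongerThan c below ℕ.+ 1) (upTo x)

hooks : List ℕ → List ℕ
hooks [] = []
hooks (x ∷ xs) = rowHooks x xs ++ hooks xs

IsCore : ℕ → List ℕ → Set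
IsCore t μ = All (λ h → ¬ (t ∣ h)) (hooks μ)

hookClassSize : (t : ℕ) .{{_ : NonZero t}} → List ℕ → ℕ → ℕ
hookClassSize t μ k = length (filter (λ h → h % t ℕ.≟ k) (hooks μ))

-- Boundary word between the two infinite rays, traversed from the bottom:
-- for rows r = ℓ, ℓ-1, …, 1: (λ_r - λ_{r+1}) horizontal edges (true = 1),
-- then one vertical edge (false = 0).
head0 : List ℕ → ℕ
head0 [] = 0
head0 (x ∷ _) = x

boundaryWord : List ℕ → List Bool
boundaryWord [] = []
boundaryWord (x ∷ xs) = boundaryWord xs ++ (replicate (x ∸ head0 xs) true ++ [ false ])

-- lookup with default 'true' (the horizontal ray continues to the right)
lookupOr1 : List Bool → ℕ → Bool
lookupOr1 [] _ = true
lookupOr1 (b ∷ bs) zero = b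
lookupOr1 (b ∷ bs) (suc n) = lookupOr1 bs n

-- The finite word
-- occupies positions -ℓ, …, λ₁ - 1; everything below is the vertical ray
-- (0), everything above is the horizontal ray (1). This indexing satisfies
-- #{j ≥ 0 : z_j = 0} = #{j < 0 : z_j = 1}.
z : List ℕ → ℤ → Bool
z μ j with j ℤ.+ (+ length μ)
... | + n      = lookupOr1 (boundaryWord μ) n
... | -[1+ _ ] = false

-- d is the value d_i, i.e. b_i = t d + i is the least j ≡ i (mod t) with z_{μ,j} = 1.
IsD : ℕ → List ℕ → ℕ → ℤ → Set
IsD t μ i d =
  (z μ (+ t ℤ.* d ℤ.+ + i) ≡ true) ×
  (∀ e → e ℤ.< d → z μ (+ t ℤ.* e ℤ.+ + i) ≡ false)

-- binom(a,2) = a(a-1)/2 for an integer a (a(a-1) is always even).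
binom2 : ℤ → ℤ
binom2 a = (a ℤ.* (a ℤ.- + 1)) /ℕ 2

B : ℕ → ℕ → List (ℕ × ℕ)
B t k = map (λ i → (i , i ℕ.+ k)) (upTo (t ∸ k))
     ++ map (λ i → (i , i ℕ.+ (t ∸ k))) (upTo k)

sumB : ℕ → ℕ → (ℕ → ℤ) → ℤ
sumB t k d = Data.List.foldr ℤ._+_ (+ 0) (map (λ p → binom2 (d (Data.Product.proj₁ p) ℤ.- d (Data.Product.proj₂ p))) (B t k))

-- Read the boundary of μ as a 01-word. The box in row y and column c is matched with the 1
-- of column c and the 0 closing row y, and its hook length is their distance; so |μ(k)|
-- counts the pairs (1 at p, 0 at q > p) with q − p ≡ k (mod t). Lay the word out on an
-- abacus with t runners. In a t-core no 1 is followed t steps later by a 0, so runner i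
-- reads 0 below level D_i = d_i + ℓ and 1 from there on. A pair at distance ≡ k joins
-- runner r to runner r + k (mod t); counting level by level, the pairs between runners
-- i < j with the 1 on i, resp. on j, are triangular numbers adding up to
-- binom(D_i − D_j, 2) = binom(d_i − d_j, 2), and the runner pairs met for k and for t − k
-- are exactly those of B_k.

module Submission where

open import Defs
open import Data.Nat using (ℕ; _<_; _≤_; _+_; _∸_; NonZero)
open import Data.Integer using (ℤ; +_)
open import Data.List using (List)
open import Data.Product using (_×_)
open import Relation.Binary.PropositionalEquality using (_≡_)

open import Data.Nat
open import Data.Nat.Properties
open import Data.Nat.DivMod using (m%n<n; m<n⇒m%n≡m; [m+n]%n≡m%n; [m+kn]%n≡m%n; %-distribˡ-+; n%n≡0; m*n/n≡m)
open import Data.Nat.Divisibility using (m%n≡0⇒n∣m)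
open import Data.Nat.Tactic.RingSolver using (solve-∀)
open import Data.Integer as ℤ using (-[1+_]; _⊖_)
import Data.Integer.Properties as ℤ
import Data.Integer.Tactic.RingSolver as ℤ
open import Data.Bool using (Bool; true; false; if_then_else_; _∧_; T)
open import Data.List using ([]; _∷_; _++_; [_]; replicate; map; applyUpTo; upTo; length; filter; foldr)
open import Data.List.Properties using (length-++; map-++; foldr-++; filter-none)
import Data.List.Relation.Unary.All as All
open import Data.Product using (_,_; proj₁; proj₂)
open import Function using (_∘_; id)
open import Relation.Nullary using (Dec; ¬_; does; yes; no; contradiction)
open import Relation.Binary.PropositionalEquality hiding ([_])
open ≡-Reasoning

T⇒≡true : ∀ {b} → T b → b ≡ true
T⇒≡true {true} _ = refl

¬T⇒≡false : ∀ {b} → ¬ T b → b ≡ false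
¬T⇒≡false {false} _  = refl
¬T⇒≡false {true}  ¬b = contradiction _ ¬b

≡ᵇ-cong : ∀ {a b c d} → (a ≡ b → c ≡ d) → (c ≡ d → a ≡ b) → (a ≡ᵇ b) ≡ (c ≡ᵇ d)
≡ᵇ-cong {a} {b} {c} {d} to from with a ≟ b | c ≟ d
... | yes a≡b | yes c≡d = trans (T⇒≡true (≡⇒≡ᵇ a b a≡b)) (sym (T⇒≡true (≡⇒≡ᵇ c d c≡d)))
... | no  a≢b | no  c≢d = trans (¬T⇒≡false (a≢b ∘ ≡ᵇ⇒≡ a b)) (sym (¬T⇒≡false (c≢d ∘ ≡ᵇ⇒≡ c d)))
... | yes a≡b | no  c≢d = contradiction (to a≡b) c≢d
... | no  a≢b | yes c≡d = contradiction (from c≡d) a≢b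

≤ᵇ-true : ∀ {m n} → m ≤ n → (m ≤ᵇ n) ≡ true
≤ᵇ-true m≤n = T⇒≡true (≤⇒≤ᵇ m≤n)

≤ᵇ-false : ∀ {m n} → n < m → (m ≤ᵇ n) ≡ false
≤ᵇ-false {m} {n} n<m = ¬T⇒≡false (λ m≤ᵇn → <⇒≱ n<m (≤ᵇ⇒≤ m n m≤ᵇn))

<ᵇ-true : ∀ {m n} → m < n → (m <ᵇ n) ≡ true
<ᵇ-true m<n = T⇒≡true (<⇒<ᵇ m<n)

<ᵇ-false : ∀ {m n} → n ≤ m → (m <ᵇ n) ≡ false
<ᵇ-false {m} {n} n≤m = ¬T⇒≡false (λ m<ᵇn → <⇒≱ (<ᵇ⇒< m n m<ᵇn) n≤m)

⟦_⟧ : Bool → ℕ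
⟦ b ⟧ = if b then 1 else 0

⟦∧⟧ : ∀ x c → ⟦ x ∧ c ⟧ ≡ (if c then ⟦ x ⟧ else 0)
⟦∧⟧ true  true  = refl
⟦∧⟧ true  false = refl
⟦∧⟧ false true  = refl
⟦∧⟧ false false = refl

if-+-if : ∀ c d X Y → (if c then X else 0) + (if d then (if c then Y else 0) else 0) ≡ (if c then X + (if d then Y else 0) else 0)
if-+-if true  d     X Y = refl
if-+-if false true  X Y = refl
if-+-if false false X Y = refl

∑ : ℕ → (ℕ → ℕ) → ℕ
∑ zero    f = 0
∑ (suc n) f = f 0 + ∑ n (f ∘ suc)

syntax ∑ n (λ i → e) = ∑[ i < n ] e

∑-cong : ∀ n {f g : ℕ → ℕ} → (∀ i → i < n → f i ≡ g i) → ∑ n f ≡ ∑ n g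
∑-cong zero    eq = refl
∑-cong (suc n) eq = cong₂ _+_ (eq 0 z<s) (∑-cong n (λ i i<n → eq (suc i) (s<s i<n)))

∑-zero : ∀ n {f : ℕ → ℕ} → (∀ i → i < n → f i ≡ 0) → ∑ n f ≡ 0
∑-zero zero    eq = refl
∑-zero (suc n) eq = cong₂ _+_ (eq 0 z<s) (∑-zero n (λ i i<n → eq (suc i) (s<s i<n)))

∑≡0⇒≡0 : ∀ n (f : ℕ → ℕ) → ∑ n f ≡ 0 → ∀ i → i < n → f i ≡ 0
∑≡0⇒≡0 (suc n) f eq zero    _         = m+n≡0⇒m≡0 (f 0) eq
∑≡0⇒≡0 (suc n) f eq (suc i) (s<s i<n) = ∑≡0⇒≡0 n (f ∘ suc) (m+n≡0⇒n≡0 (f 0) eq) i i<n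

∑-distrib-+ : ∀ n (f g : ℕ → ℕ) → ∑[ i < n ] (f i + g i) ≡ ∑ n f + ∑ n g
∑-distrib-+ zero    f g = refl
∑-distrib-+ (suc n) f g = begin
  f 0 + g 0 + ∑[ i < n ] (f (suc i) + g (suc i))
    ≡⟨ cong (_+_ (f 0 + g 0)) (∑-distrib-+ n (f ∘ suc) (g ∘ suc)) ⟩
  f 0 + g 0 + (∑ n (f ∘ suc) + ∑ n (g ∘ suc))
    ≡⟨ interchange (f 0) (g 0) _ _ ⟩
  f 0 + ∑ n (f ∘ suc) + (g 0 + ∑ n (g ∘ suc)) ∎
  where
  interchange : ∀ a b c d → a + b + (c + d) ≡ a + c + (b + d)
  interchange = solve-∀

∑-++ : ∀ m n (f : ℕ → ℕ) → ∑ (m + n) f ≡ ∑ m f + ∑[ i < n ] f (m + i)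
∑-++ zero    n f = refl
∑-++ (suc m) n f = trans (cong (_+_ (f 0)) (∑-++ m n (f ∘ suc))) (sym (+-assoc (f 0) _ _))

∑-last : ∀ n (f : ℕ → ℕ) → ∑ (suc n) f ≡ ∑ n f + f n
∑-last zero    f = +-identityʳ (f 0)
∑-last (suc n) f = trans (cong (_+_ (f 0)) (∑-last n (f ∘ suc))) (sym (+-assoc (f 0) _ _))

∑-comm : ∀ m n (f : ℕ → ℕ → ℕ) → ∑[ i < m ] ∑[ j < n ] f i j ≡ ∑[ j < n ] ∑[ i < m ] f i j
∑-comm zero    n f = sym (∑-zero n (λ _ _ → refl))
∑-comm (suc m) n f = begin
  ∑[ j < n ] f 0 j + ∑[ i < m ] ∑[ j < n ] f (suc i) j
    ≡⟨ cong (_+_ (∑[ j < n ] f 0 j)) (∑-comm m n (f ∘ suc)) ⟩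
  ∑[ j < n ] f 0 j + ∑[ j < n ] ∑[ i < m ] f (suc i) j
    ≡⟨ ∑-distrib-+ n (f 0) _ ⟨
  ∑[ j < n ] (f 0 j + ∑[ i < m ] f (suc i) j) ∎

∑-blocks : ∀ b t (f : ℕ → ℕ) → ∑ (b * t) f ≡ ∑[ a < b ] ∑[ r < t ] f (a * t + r)
∑-blocks zero    t f = refl
∑-blocks (suc b) t f = begin
  ∑ (t + b * t) f
    ≡⟨ ∑-++ t (b * t) f ⟩
  ∑ t f + ∑[ i < b * t ] f (t + i)
    ≡⟨ cong (_+_ (∑ t f)) (∑-blocks b t (λ i → f (t + i))) ⟩
  ∑ t f + ∑[ a < b ] ∑[ r < t ] f (t + (a * t + r))
    ≡⟨ cong (_+_ (∑ t f)) (∑-cong b (λ a _ → ∑-cong t (λ r _ → cong f (sym (+-assoc t (a * t) r))))) ⟩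
  ∑ t f + ∑[ a < b ] ∑[ r < t ] f (t + a * t + r) ∎

∑-truncate : ∀ {m n} (f g : ℕ → ℕ) → n ≤ m →
  (∀ i → i < n → g i ≡ f i) → (∀ i → n ≤ i → g i ≡ 0) → ∑ m g ≡ ∑ n f
∑-truncate {m} {n} f g n≤m inside outside with m≤n⇒∃[o]m+o≡n n≤m
... | o , refl = begin
  ∑ (n + o) g                     ≡⟨ ∑-++ n o g ⟩
  ∑ n g + ∑[ i < o ] g (n + i)    ≡⟨ cong₂ _+_ (∑-cong n inside) (∑-zero o (λ i _ → outside (n + i) (m≤m+n n i))) ⟩
  ∑ n f + 0                       ≡⟨ +-identityʳ _ ⟩
  ∑ n f                           ∎

∑-<ᵇ : ∀ {s n} (f : ℕ → ℕ) → s ≤ n → ∑[ r < n ] (if r <ᵇ s then f r else 0) ≡ ∑ s f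
∑-<ᵇ f s≤n = ∑-truncate f _ s≤n (λ r r<s → cong (λ c → if c then f r else 0) (<ᵇ-true r<s))
                                 (λ r s≤r → cong (λ c → if c then f r else 0) (<ᵇ-false s≤r))

∑-pick : ∀ n j (f : ℕ → ℕ) → j < n → ∑[ s < n ] (if s ≡ᵇ j then f s else 0) ≡ f j
∑-pick (suc n) zero    f _         = trans (cong (_+_ (f 0)) (∑-zero n (λ _ _ → refl))) (+-identityʳ _)
∑-pick (suc n) (suc j) f (s<s j<n) = ∑-pick n j (f ∘ suc) j<n

∑-if : ∀ n c (f : ℕ → ℕ) → ∑[ i < n ] (if c then f i else 0) ≡ (if c then ∑ n f else 0)
∑-if n true  f = refl
∑-if n false f = ∑-zero n (λ _ _ → refl)

∑-≤ᵇ : ∀ D b → ∑[ a < b ] ⟦ D ≤ᵇ a ⟧ ≡ b ∸ D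
∑-≤ᵇ D zero = sym (0∸n≡0 D)
∑-≤ᵇ D (suc b) with D ≤? b
... | yes D≤b = begin
  ∑[ a < suc b ] ⟦ D ≤ᵇ a ⟧          ≡⟨ ∑-last b _ ⟩
  ∑[ a < b ] ⟦ D ≤ᵇ a ⟧ + ⟦ D ≤ᵇ b ⟧  ≡⟨ cong₂ _+_ (∑-≤ᵇ D b) (cong ⟦_⟧ (≤ᵇ-true D≤b)) ⟩
  b ∸ D + 1                          ≡⟨ trans (+-∸-assoc 1 D≤b) (+-comm 1 _) ⟨
  suc b ∸ D                          ∎
... | no D≰b = begin
  ∑[ a < suc b ] ⟦ D ≤ᵇ a ⟧          ≡⟨ ∑-last b _ ⟩
  ∑[ a < b ] ⟦ D ≤ᵇ a ⟧ + ⟦ D ≤ᵇ b ⟧  ≡⟨ cong₂ _+_ (∑-≤ᵇ D b) (cong ⟦_⟧ (≤ᵇ-false b<D)) ⟩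
  b ∸ D + 0                          ≡⟨ cong (_+ 0) (m≤n⇒m∸n≡0 (<⇒≤ b<D)) ⟩
  0                                  ≡⟨ m≤n⇒m∸n≡0 b<D ⟨
  suc b ∸ D                          ∎
  where b<D = ≰⇒> D≰b

∑-≤ᵇ-+ : ∀ D b c → ∑[ a < b ] ⟦ D ≤ᵇ a ⟧ + (if c then ⟦ D ≤ᵇ b ⟧ else 0) ≡ (b + ⟦ c ⟧) ∸ D
∑-≤ᵇ-+ D b false = trans (+-identityʳ _) (trans (∑-≤ᵇ D b) (cong (_∸ D) (sym (+-identityʳ b))))
∑-≤ᵇ-+ D b true  = trans (sym (∑-last b _)) (trans (∑-≤ᵇ D (suc b)) (cong (_∸ D) (+-comm 1 b)))

triangle : ℕ → ℕ
triangle n = ∑[ b < n ] b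

∑-∸ : ∀ n m → ∑[ b < n ] (b ∸ m) ≡ triangle (n ∸ m)
∑-∸ n m with m ≤? n
... | yes m≤n with m≤n⇒∃[o]m+o≡n m≤n
...   | o , refl = begin
  ∑[ b < m + o ] (b ∸ m)                       ≡⟨ ∑-++ m o _ ⟩
  ∑[ b < m ] (b ∸ m) + ∑[ i < o ] (m + i ∸ m)
    ≡⟨ cong₂ _+_ (∑-zero m (λ b b<m → m≤n⇒m∸n≡0 (<⇒≤ b<m))) (∑-cong o (λ i _ → m+n∸m≡n m i)) ⟩
  triangle o                                   ≡⟨ cong triangle (m+n∸m≡n m o) ⟨
  triangle (m + o ∸ m)                         ∎
∑-∸ n m | no m≰n = begin
  ∑[ b < n ] (b ∸ m)   ≡⟨ ∑-zero n (λ b b<n → m≤n⇒m∸n≡0 (<⇒≤ (<-≤-trans b<n n≤m))) ⟩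
  0                    ≡⟨ cong triangle (m≤n⇒m∸n≡0 n≤m) ⟨
  triangle (n ∸ m)     ∎
  where n≤m = <⇒≤ (≰⇒> m≰n)

-- Hooks as pairs of edges of the boundary word

count : (ℕ → Bool) → List ℕ → ℕ
count R []       = 0
count R (x ∷ xs) = ⟦ R x ⟧ + count R xs

length-filter≡count : ∀ {P : ℕ → Set} (P? : ∀ x → Dec (P x)) xs →
  length (filter P? xs) ≡ count (does ∘ P?) xs
length-filter≡count P? [] = refl
length-filter≡count P? (x ∷ xs) with does (P? x)
... | true  = cong suc (length-filter≡count P? xs)
... | false = length-filter≡count P? xs

count-++ : ∀ R xs ys → count R (xs ++ ys) ≡ count R xs + count R ys
count-++ R []       ys = refl
count-++ R (x ∷ xs) ys = trans (cong (_+_ (⟦ R x ⟧)) (count-++ R xs ys)) (sym (+-assoc ⟦ R x ⟧ _ _))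

count-map-applyUpTo : ∀ R (g f : ℕ → ℕ) n → count R (map g (applyUpTo f n)) ≡ ∑[ c < n ] ⟦ R (g (f c)) ⟧
count-map-applyUpTo R g f zero    = refl
count-map-applyUpTo R g f (suc n) = cong (_+_ (⟦ R (g (f 0)) ⟧)) (count-map-applyUpTo R g (f ∘ suc) n)

onesBefore : (ℕ → Bool) → ℕ → (ℕ → Bool) → ℕ
onesBefore Z q R = ∑[ p < q ] ⟦ Z p ∧ R (q ∸ p) ⟧

pairCount : ℕ → (ℕ → Bool) → (ℕ → Bool) → ℕ
pairCount L Z R = ∑[ q < L ] (if Z q then 0 else onesBefore Z q R)

rowEdges : ℕ → List Bool
rowEdges m = replicate m true ++ [ false ]

lookupOr1-++ˡ : ∀ u v {n} → n < length u → lookupOr1 (u ++ v) n ≡ lookupOr1 u n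
lookupOr1-++ˡ (b ∷ u) v {zero}  _         = refl
lookupOr1-++ˡ (b ∷ u) v {suc n} (s<s n<u) = lookupOr1-++ˡ u v n<u

lookupOr1-++ʳ : ∀ u v n → lookupOr1 (u ++ v) (length u + n) ≡ lookupOr1 v n
lookupOr1-++ʳ []      v n = refl
lookupOr1-++ʳ (b ∷ u) v n = lookupOr1-++ʳ u v n

lookupOr1-rowEdges-< : ∀ m {i} → i < m → lookupOr1 (rowEdges m) i ≡ true
lookupOr1-rowEdges-< (suc m) {zero}  _         = refl
lookupOr1-rowEdges-< (suc m) {suc i} (s<s i<m) = lookupOr1-rowEdges-< m i<m

lookupOr1-rowEdges-end : ∀ m → lookupOr1 (rowEdges m) m ≡ false
lookupOr1-rowEdges-end zero    = refl
lookupOr1-rowEdges-end (suc m) = lookupOr1-rowEdges-end m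

length-++-rowEdges : ∀ (u : List Bool) m → length (u ++ rowEdges m) ≡ length u + suc m
length-++-rowEdges u m = trans (length-++ u) (cong (_+_ (length u)) (length-rowEdges m))
  where
  length-rowEdges : ∀ m → length (rowEdges m) ≡ suc m
  length-rowEdges zero    = refl
  length-rowEdges (suc m) = cong suc (length-rowEdges m)

module _ (u : List Bool) (m : ℕ) where

  private
    w = u ++ rowEdges m

  lookup-prefix : ∀ {p} → p < length u → lookupOr1 w p ≡ lookupOr1 u p
  lookup-prefix = lookupOr1-++ˡ u (rowEdges m)

  lookup-ones : ∀ {i} → i < m → lookupOr1 w (length u + i) ≡ true
  lookup-ones i<m = trans (lookupOr1-++ʳ u (rowEdges m) _) (lookupOr1-rowEdges-< m i<m)

  lookup-zero : lookupOr1 w (length u + m) ≡ false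
  lookup-zero = trans (lookupOr1-++ʳ u (rowEdges m) m) (lookupOr1-rowEdges-end m)

  onesBefore-prefix : ∀ {q} R → q ≤ length u → onesBefore (lookupOr1 w) q R ≡ onesBefore (lookupOr1 u) q R
  onesBefore-prefix R q≤u = ∑-cong _ (λ p p<q → cong (λ b → ⟦ b ∧ _ ⟧) (lookup-prefix (<-≤-trans p<q q≤u)))

  onesBefore-ones : ∀ {j} R → j ≤ m →
    onesBefore (lookupOr1 w) (length u + j) R
      ≡ onesBefore (lookupOr1 u) (length u) (λ h → R (h + j)) + ∑[ i < j ] ⟦ R (j ∸ i) ⟧
  onesBefore-ones {j} R j≤m = trans (∑-++ (length u) j _) (cong₂ _+_
    (∑-cong (length u) (λ p p<u → cong₂ (λ b h → ⟦ b ∧ R h ⟧) (lookup-prefix p<u) (+-∸-comm j (<⇒≤ p<u))))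
    (∑-cong j (λ i i<j → cong₂ (λ b h → ⟦ b ∧ R h ⟧) (lookup-ones (<-≤-trans i<j j≤m))
                                                    ([m+n]∸[m+o]≡n∸o (length u) j i))))

onesBefore-suc : ∀ Z q R → onesBefore Z (suc q) R ≡ onesBefore Z q (R ∘ suc) + ⟦ Z q ∧ R 1 ⟧
onesBefore-suc Z q R = trans (∑-last q _) (cong₂ _+_
  (∑-cong q (λ p p<q → cong (λ h → ⟦ Z p ∧ R h ⟧) (+-∸-assoc 1 (<⇒≤ p<q))))
  (cong (λ h → ⟦ Z q ∧ R h ⟧) (m+n∸n≡m 1 q)))

onesBeforeEnd : List Bool → (ℕ → Bool) → ℕ
onesBeforeEnd u R = onesBefore (lookupOr1 u) (length u) R

pairCountWord : List Bool → (ℕ → Bool) → ℕ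
pairCountWord u R = pairCount (length u) (lookupOr1 u) R

module _ (u : List Bool) (m : ℕ) (R : ℕ → Bool) where

  private
    w = u ++ rowEdges m

  onesBeforeEnd-++-rowEdges :
    onesBeforeEnd w R ≡ onesBeforeEnd u (λ h → R (suc (h + m))) + ∑[ i < m ] ⟦ R (suc (m ∸ i)) ⟧
  onesBeforeEnd-++-rowEdges = begin
    onesBefore (lookupOr1 w) (length w) R
      ≡⟨ cong (λ q → onesBefore (lookupOr1 w) q R) (trans (length-++-rowEdges u m) (+-suc (length u) m)) ⟩
    onesBefore (lookupOr1 w) (suc (length u + m)) R
      ≡⟨ onesBefore-suc (lookupOr1 w) (length u + m) R ⟩
    onesBefore (lookupOr1 w) (length u + m) (R ∘ suc) + ⟦ lookupOr1 w (length u + m) ∧ R 1 ⟧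
      ≡⟨ cong₂ _+_ (onesBefore-ones u m (R ∘ suc) ≤-refl) (cong (λ b → ⟦ b ∧ R 1 ⟧) (lookup-zero u m)) ⟩
    onesBeforeEnd u (λ h → R (suc (h + m))) + ∑[ i < m ] ⟦ R (suc (m ∸ i)) ⟧ + 0
      ≡⟨ +-identityʳ _ ⟩
    onesBeforeEnd u (λ h → R (suc (h + m))) + ∑[ i < m ] ⟦ R (suc (m ∸ i)) ⟧ ∎

  pairCountWord-++-rowEdges :
    pairCountWord w R ≡ pairCountWord u R + (onesBeforeEnd u (λ h → R (h + m)) + ∑[ i < m ] ⟦ R (m ∸ i) ⟧)
  pairCountWord-++-rowEdges = begin
    ∑[ q < length w ] column q
      ≡⟨ cong (λ L → ∑[ q < L ] column q) (length-++-rowEdges u m) ⟩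
    ∑[ q < length u + suc m ] column q
      ≡⟨ ∑-++ (length u) (suc m) column ⟩
    ∑[ q < length u ] column q + ∑[ i < suc m ] column (length u + i)
      ≡⟨ cong₂ _+_ oldColumns (∑-last m _) ⟩
    pairCountWord u R + (∑[ i < m ] column (length u + i) + column (length u + m))
      ≡⟨ cong (λ x → pairCountWord u R + (x + column (length u + m))) (∑-zero m (λ i → newOnes)) ⟩
    pairCountWord u R + column (length u + m)
      ≡⟨ cong (λ b → pairCountWord u R + (if b then 0 else onesBefore (lookupOr1 w) (length u + m) R)) (lookup-zero u m) ⟩
    pairCountWord u R + onesBefore (lookupOr1 w) (length u + m) R
      ≡⟨ cong (_+_ (pairCountWord u R)) (onesBefore-ones u m R ≤-refl) ⟩
    pairCountWord u R + (onesBeforeEnd u (λ h → R (h + m)) + ∑[ i < m ] ⟦ R (m ∸ i) ⟧) ∎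
    where
    column : ℕ → ℕ
    column q = if lookupOr1 w q then 0 else onesBefore (lookupOr1 w) q R
    newOnes : ∀ {i} → i < m → column (length u + i) ≡ 0
    newOnes {i} i<m = cong (λ b → if b then 0 else onesBefore (lookupOr1 w) (length u + i) R) (lookup-ones u m i<m)
    oldColumns : ∑[ q < length u ] column q ≡ pairCountWord u R
    oldColumns = ∑-cong (length u) (λ q q<u → cong₂ (λ b n → if b then 0 else n)
      (lookup-prefix u m q<u) (onesBefore-prefix u m R (<⇒≤ q<u)))

decreasing-tail : ∀ {x xs} → Decreasing (x ∷ xs) → head0 xs ≤ x × Decreasing xs
decreasing-tail dec-one          = z≤n , dec-nil
decreasing-tail (dec-cons y≤x d) = y≤x , d

rowsLongerThan-< : ∀ {c y} ys → c < y → rowsLongerThan c (y ∷ ys) ≡ suc (rowsLongerThan c ys)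
rowsLongerThan-< {c} {y} ys c<y with c <? y
... | yes _   = refl
... | no  c≮y = contradiction c<y c≮y

rowsLongerThan-≥ : ∀ {xs} → Decreasing xs → ∀ {c} → head0 xs ≤ c → rowsLongerThan c xs ≡ 0
rowsLongerThan-≥ dec-nil _ = refl
rowsLongerThan-≥ {x ∷ xs} d {c} x≤c with c <? x
... | yes c<x = contradiction x≤c (<⇒≱ c<x)
... | no  _   = rowsLongerThan-≥ (proj₂ (decreasing-tail d)) (≤-trans (proj₁ (decreasing-tail d)) x≤c)

∸-suc-+1 : ∀ {c x} → c < x → x ∸ suc c + 1 ≡ x ∸ c
∸-suc-+1 c<x = trans (+-comm _ 1) (sym (+-∸-assoc 1 c<x))

-- The 0 closing row y is the last letter of this word, so distances to its end exceed
-- the hook lengths of row y by one.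
onesBeforeEnd-boundaryWord : ∀ {y ys} → Decreasing (y ∷ ys) → ∀ R →
  onesBeforeEnd (boundaryWord (y ∷ ys)) R ≡ count (R ∘ suc) (rowHooks y ys)

count-rowHooks : ∀ {x xs a} → Decreasing (x ∷ xs) → head0 xs + a ≡ x → ∀ R →
  count R (rowHooks x xs) ≡ onesBeforeEnd (boundaryWord xs) (λ h → R (h + a)) + ∑[ i < a ] ⟦ R (a ∸ i) ⟧

onesBeforeEnd-boundaryWord {y} {ys} d R =
  trans (onesBeforeEnd-++-rowEdges (boundaryWord ys) m R)
        (sym (count-rowHooks d (m+[n∸m]≡n (proj₁ (decreasing-tail d))) (R ∘ suc)))
  where m = y ∸ head0 ys

count-rowHooks {a = a} dec-one refl R = trans (count-map-applyUpTo R _ id a)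
  (∑-cong a (λ c c<a → cong (λ h → ⟦ R h ⟧) (trans (cong (_+ 1) (+-identityʳ _)) (∸-suc-+1 c<a))))
count-rowHooks {xs = y ∷ ys} {a} (dec-cons _ d) refl R = begin
  count R (rowHooks (y + a) (y ∷ ys))
    ≡⟨ count-map-applyUpTo R _ id (y + a) ⟩
  ∑[ c < y + a ] ⟦ R (hook c) ⟧
    ≡⟨ ∑-++ y a _ ⟩
  ∑[ c < y ] ⟦ R (hook c) ⟧ + ∑[ i < a ] ⟦ R (hook (y + i)) ⟧
    ≡⟨ cong₂ _+_ (∑-cong y (λ c c<y → cong (λ h → ⟦ R h ⟧) (hook-left c<y)))
                 (∑-cong a (λ i i<a → cong (λ h → ⟦ R h ⟧) (hook-right i<a))) ⟩
  ∑[ c < y ] ⟦ R (suc (y ∸ suc c + rowsLongerThan c ys + 1) + a) ⟧ + ∑[ i < a ] ⟦ R (a ∸ i) ⟧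
    ≡⟨ cong (_+ ∑[ i < a ] ⟦ R (a ∸ i) ⟧) (count-map-applyUpTo (λ h → R (suc h + a)) _ id y) ⟨
  count (λ h → R (suc h + a)) (rowHooks y ys) + ∑[ i < a ] ⟦ R (a ∸ i) ⟧
    ≡⟨ cong (_+ ∑[ i < a ] ⟦ R (a ∸ i) ⟧) (onesBeforeEnd-boundaryWord d (λ h → R (h + a))) ⟨
  onesBeforeEnd (boundaryWord (y ∷ ys)) (λ h → R (h + a)) + ∑[ i < a ] ⟦ R (a ∸ i) ⟧ ∎
  where
  hook : ℕ → ℕ
  hook c = (y + a) ∸ suc c + rowsLongerThan c (y ∷ ys) + 1
  hook-left : ∀ {c} → c < y → hook c ≡ suc (y ∸ suc c + rowsLongerThan c ys + 1) + a
  hook-left {c} c<y rewrite rowsLongerThan-< ys c<y | +-∸-comm {y} a c<y = shuffle (y ∸ suc c) (rowsLongerThan c ys) a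
    where
    shuffle : ∀ m r a → m + a + suc r + 1 ≡ suc (m + r + 1) + a
    shuffle = solve-∀
  hook-right : ∀ {i} → i < a → hook (y + i) ≡ a ∸ i
  hook-right {i} i<a = begin
    (y + a) ∸ suc (y + i) + rowsLongerThan (y + i) (y ∷ ys) + 1
      ≡⟨ cong₂ (λ m r → m + r + 1) (cong ((y + a) ∸_) (sym (+-suc y i))) (rowsLongerThan-≥ d (m≤m+n y i)) ⟩
    (y + a) ∸ (y + suc i) + 0 + 1
      ≡⟨ cong (λ m → m + 1) (trans (+-identityʳ _) ([m+n]∸[m+o]≡n∸o y a (suc i))) ⟩
    a ∸ suc i + 1
      ≡⟨ ∸-suc-+1 i<a ⟩
    a ∸ i ∎

hooks-pairCount : ∀ {μ} → Decreasing μ → ∀ R → count R (hooks μ) ≡ pairCountWord (boundaryWord μ) R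
hooks-pairCount dec-nil R = refl
hooks-pairCount {x ∷ xs} d R = begin
  count R (rowHooks x xs ++ hooks xs)
    ≡⟨ count-++ R (rowHooks x xs) (hooks xs) ⟩
  count R (rowHooks x xs) + count R (hooks xs)
    ≡⟨ cong₂ _+_ (count-rowHooks d (m+[n∸m]≡n (proj₁ (decreasing-tail d))) R)
                 (hooks-pairCount (proj₂ (decreasing-tail d)) R) ⟩
  onesBeforeEnd (boundaryWord xs) (λ h → R (h + m)) + ∑[ i < m ] ⟦ R (m ∸ i) ⟧ + pairCountWord (boundaryWord xs) R
    ≡⟨ +-comm _ (pairCountWord (boundaryWord xs) R) ⟩
  pairCountWord (boundaryWord xs) R + (onesBeforeEnd (boundaryWord xs) (λ h → R (h + m)) + ∑[ i < m ] ⟦ R (m ∸ i) ⟧)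
    ≡⟨ pairCountWord-++-rowEdges (boundaryWord xs) m R ⟨
  pairCountWord (boundaryWord (x ∷ xs)) R ∎
  where m = x ∸ head0 xs

-- The abacus with t runners

-- Pairs of a 1 on runner r and a later 0 on runner s, when each runner x is 0 below
-- level D x and 1 from there on.
runnerPairs : (ℕ → ℕ) → ℕ → ℕ → ℕ
runnerPairs D r s = ∑[ b < D s ] ((b + ⟦ r <ᵇ s ⟧) ∸ D r)

module Runners (t : ℕ) .{{_ : NonZero t}} where

  σ : ℕ → ℕ → ℕ
  σ k r = (r + k) % t

  σ<t : ∀ k r → σ k r < t
  σ<t k r = m%n<n (r + k) t

  %-cancelʳ-+ : ∀ x y r → (x + r) % t ≡ (y + r) % t → x % t ≡ y % t
  %-cancelʳ-+ x y r eq = begin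
    x % t                               ≡⟨ shift x ⟩
    ((x + r) % t + (r * t ∸ r) % t) % t ≡⟨ cong (λ a → (a + (r * t ∸ r) % t) % t) eq ⟩
    ((y + r) % t + (r * t ∸ r) % t) % t ≡⟨ shift y ⟨
    y % t                               ∎
    where
    shift : ∀ x → x % t ≡ ((x + r) % t + (r * t ∸ r) % t) % t
    shift x = begin
      x % t                    ≡⟨ [m+kn]%n≡m%n x r t ⟨
      (x + r * t) % t          ≡⟨ cong (λ a → (x + a) % t) (m+[n∸m]≡n (m≤m*n r t)) ⟨
      (x + (r + (r * t ∸ r))) % t ≡⟨ cong (_% t) (+-assoc x r _) ⟨
      (x + r + (r * t ∸ r)) % t ≡⟨ %-distribˡ-+ (x + r) _ t ⟩
      ((x + r) % t + (r * t ∸ r) % t) % t ∎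

  residue-≡ᵇ : ∀ Δ {r s k} → r < t → k < t → (Δ + r) % t ≡ s → ((Δ % t) ≡ᵇ k) ≡ (s ≡ᵇ σ k r)
  residue-≡ᵇ Δ {r} {s} {k} r<t k<t eq = ≡ᵇ-cong to from
    where
    to : Δ % t ≡ k → s ≡ σ k r
    to Δ≡k = begin
      s                       ≡⟨ eq ⟨
      (Δ + r) % t             ≡⟨ %-distribˡ-+ Δ r t ⟩
      (Δ % t + r % t) % t     ≡⟨ cong₂ (λ a b → (a + b) % t) Δ≡k (m<n⇒m%n≡m r<t) ⟩
      (k + r) % t             ≡⟨ cong (_% t) (+-comm k r) ⟩
      σ k r                   ∎
    from : s ≡ σ k r → Δ % t ≡ k
    from s≡σ = trans (%-cancelʳ-+ Δ k r (trans eq (trans s≡σ (cong (_% t) (+-comm r k)))))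
                     (m<n⇒m%n≡m k<t)

  residue-of-difference : ∀ a b {r s} → s < t → a * t + r ≤ b * t + s →
    ((b * t + s) ∸ (a * t + r) + r) % t ≡ s
  residue-of-difference a b {r} {s} s<t le = begin
    (Δ + r) % t          ≡⟨ [m+kn]%n≡m%n (Δ + r) a t ⟨
    (Δ + r + a * t) % t  ≡⟨ cong (_% t) (trans (+-assoc Δ r _) (trans (cong (_+_ Δ) (+-comm r _)) (m∸n+n≡m le))) ⟩
    (b * t + s) % t      ≡⟨ cong (_% t) (+-comm (b * t) s) ⟩
    (s + b * t) % t      ≡⟨ [m+kn]%n≡m%n s b t ⟩
    s % t                ≡⟨ m<n⇒m%n≡m s<t ⟩
    s                    ∎
    where Δ = (b * t + s) ∸ (a * t + r)

  module _ (D : ℕ → ℕ) (Z : ℕ → Bool) (onRunners : ∀ b s → s < t → Z (b * t + s) ≡ (D s ≤ᵇ b))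
           {k : ℕ} (k<t : k < t) where

    private
      R : ℕ → Bool
      R h = h % t ≡ᵇ k

    onesBefore-runners : ∀ b {s} → s < t →
      onesBefore Z (b * t + s) R ≡ ∑[ r < t ] (if s ≡ᵇ σ k r then (b + ⟦ r <ᵇ s ⟧) ∸ D r else 0)
    onesBefore-runners b {s} s<t = begin
      ∑[ p < b * t + s ] f p
        ≡⟨ ∑-++ (b * t) s f ⟩
      ∑[ p < b * t ] f p + ∑[ r < s ] f (b * t + r)
        ≡⟨ cong₂ _+_ (∑-blocks b t f) (sym (∑-<ᵇ (λ r → f (b * t + r)) (<⇒≤ s<t))) ⟩
      ∑[ a < b ] ∑[ r < t ] f (a * t + r) + ∑[ r < t ] (if r <ᵇ s then f (b * t + r) else 0)
        ≡⟨ cong (_+ ∑[ r < t ] (if r <ᵇ s then f (b * t + r) else 0)) (∑-comm b t _) ⟩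
      ∑[ r < t ] ∑[ a < b ] f (a * t + r) + ∑[ r < t ] (if r <ᵇ s then f (b * t + r) else 0)
        ≡⟨ ∑-distrib-+ t _ _ ⟨
      ∑[ r < t ] (∑[ a < b ] f (a * t + r) + (if r <ᵇ s then f (b * t + r) else 0))
        ≡⟨ ∑-cong t runner ⟩
      ∑[ r < t ] (if s ≡ᵇ σ k r then (b + ⟦ r <ᵇ s ⟧) ∸ D r else 0) ∎
      where
      f : ℕ → ℕ
      f p = ⟦ Z p ∧ R (b * t + s ∸ p) ⟧
      f-runner : ∀ a {r} → r < t → a * t + r ≤ b * t + s → f (a * t + r) ≡ (if s ≡ᵇ σ k r then ⟦ D r ≤ᵇ a ⟧ else 0)
      f-runner a r<t le = trans
        (cong₂ (λ x c → ⟦ x ∧ c ⟧) (onRunners a _ r<t) (residue-≡ᵇ _ r<t k<t (residue-of-difference a b s<t le)))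
        (⟦∧⟧ (D _ ≤ᵇ a) (s ≡ᵇ σ k _))
      lower-row : ∀ {a r} → a < b → r < t → a * t + r ≤ b * t + s
      lower-row {a} {r} a<b r<t = ≤-trans (<⇒≤ (+-monoʳ-< (a * t) r<t)) (≤-trans (≤-reflexive (+-comm (a * t) t))
                                    (≤-trans (*-monoˡ-≤ t a<b) (m≤m+n (b * t) s)))
      same-row : ∀ {r} → r < t →
        (if r <ᵇ s then f (b * t + r) else 0) ≡ (if r <ᵇ s then (if s ≡ᵇ σ k r then ⟦ D r ≤ᵇ b ⟧ else 0) else 0)
      same-row {r} r<t with r <ᵇ s in r<ᵇs
      ... | false = refl
      ... | true  = f-runner b r<t (+-monoʳ-≤ (b * t) (<⇒≤ (<ᵇ⇒< r s (subst T (sym r<ᵇs) _))))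
      runner : ∀ r → r < t → ∑[ a < b ] f (a * t + r) + (if r <ᵇ s then f (b * t + r) else 0)
                            ≡ (if s ≡ᵇ σ k r then (b + ⟦ r <ᵇ s ⟧) ∸ D r else 0)
      runner r r<t = begin
        ∑[ a < b ] f (a * t + r) + (if r <ᵇ s then f (b * t + r) else 0)
          ≡⟨ cong₂ _+_ (∑-cong b (λ a a<b → f-runner a r<t (lower-row a<b r<t))) (same-row r<t) ⟩
        ∑[ a < b ] (if c then ⟦ D r ≤ᵇ a ⟧ else 0) + (if r <ᵇ s then (if c then ⟦ D r ≤ᵇ b ⟧ else 0) else 0)
          ≡⟨ cong (_+ (if r <ᵇ s then (if c then ⟦ D r ≤ᵇ b ⟧ else 0) else 0)) (∑-if b c _) ⟩
        (if c then ∑[ a < b ] ⟦ D r ≤ᵇ a ⟧ else 0) + (if r <ᵇ s then (if c then ⟦ D r ≤ᵇ b ⟧ else 0) else 0)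
          ≡⟨ if-+-if c (r <ᵇ s) _ _ ⟩
        (if c then ∑[ a < b ] ⟦ D r ≤ᵇ a ⟧ + (if r <ᵇ s then ⟦ D r ≤ᵇ b ⟧ else 0) else 0)
          ≡⟨ cong (λ x → if c then x else 0) (∑-≤ᵇ-+ (D r) b (r <ᵇ s)) ⟩
        (if c then (b + ⟦ r <ᵇ s ⟧) ∸ D r else 0) ∎
        where c = s ≡ᵇ σ k r

    pairCount-runners : ∀ E → (∀ s → s < t → D s ≤ E) → pairCount (E * t) Z R ≡ ∑[ r < t ] runnerPairs D r (σ k r)
    pairCount-runners E D≤E = begin
      ∑[ q < E * t ] column q
        ≡⟨ ∑-blocks E t column ⟩
      ∑[ b < E ] ∑[ s < t ] column (b * t + s)
        ≡⟨ ∑-comm E t _ ⟩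
      ∑[ s < t ] ∑[ b < E ] column (b * t + s)
        ≡⟨ ∑-cong t (λ s s<t → ∑-truncate _ _ (D≤E s s<t) (λ b → empty s<t) (λ b → full s<t)) ⟩
      ∑[ s < t ] ∑[ b < D s ] onesBefore Z (b * t + s) R
        ≡⟨ ∑-cong t (λ s s<t → ∑-cong (D s) (λ b _ → onesBefore-runners b s<t)) ⟩
      ∑[ s < t ] ∑[ b < D s ] ∑[ r < t ] (if s ≡ᵇ σ k r then X b r s else 0)
        ≡⟨ ∑-cong t (λ s _ → ∑-comm (D s) t _) ⟩
      ∑[ s < t ] ∑[ r < t ] ∑[ b < D s ] (if s ≡ᵇ σ k r then X b r s else 0)
        ≡⟨ ∑-cong t (λ s _ → ∑-cong t (λ r _ → ∑-if (D s) (s ≡ᵇ σ k r) _)) ⟩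
      ∑[ s < t ] ∑[ r < t ] (if s ≡ᵇ σ k r then runnerPairs D r s else 0)
        ≡⟨ ∑-comm t t _ ⟩
      ∑[ r < t ] ∑[ s < t ] (if s ≡ᵇ σ k r then runnerPairs D r s else 0)
        ≡⟨ ∑-cong t (λ r _ → ∑-pick t (σ k r) (runnerPairs D r) (σ<t k r)) ⟩
      ∑[ r < t ] runnerPairs D r (σ k r) ∎
      where
      column : ℕ → ℕ
      column q = if Z q then 0 else onesBefore Z q R
      empty : ∀ {b s} → s < t → b < D s → column (b * t + s) ≡ onesBefore Z (b * t + s) R
      empty {b} {s} s<t b<D = cong (λ c → if c then 0 else onesBefore Z (b * t + s) R) (trans (onRunners b s s<t) (≤ᵇ-false b<D))
      full : ∀ {b s} → s < t → D s ≤ b → column (b * t + s) ≡ 0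
      full {b} {s} s<t D≤b = cong (λ c → if c then 0 else onesBefore Z (b * t + s) R) (trans (onRunners b s s<t) (≤ᵇ-true D≤b))
      X : ℕ → ℕ → ℕ → ℕ
      X b r s = (b + ⟦ r <ᵇ s ⟧) ∸ D r

  ∑-σ : ∀ (F : ℕ → ℕ → ℕ) {a k} → a + k ≡ t →
    ∑[ r < t ] F r (σ k r) ≡ ∑[ i < a ] F i (i + k) + ∑[ i < k ] F (i + a) i
  ∑-σ F {a} {k} a+k≡t = begin
    ∑[ r < t ] F r (σ k r)                                   ≡⟨ cong (λ n → ∑[ r < n ] F r (σ k r)) a+k≡t ⟨
    ∑[ r < a + k ] F r (σ k r)                               ≡⟨ ∑-++ a k _ ⟩
    ∑[ r < a ] F r (σ k r) + ∑[ i < k ] F (a + i) (σ k (a + i))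
      ≡⟨ cong₂ _+_ (∑-cong a (λ r r<a → cong (F r) (m<n⇒m%n≡m (subst (r + k <_) a+k≡t (+-monoˡ-< k r<a)))))
                   (∑-cong k (λ i i<k → cong₂ F (+-comm a i) (wraps i<k))) ⟩
    ∑[ i < a ] F i (i + k) + ∑[ i < k ] F (i + a) i          ∎
    where
    wraps : ∀ {i} → i < k → σ k (a + i) ≡ i
    wraps {i} i<k = begin
      (a + i + k) % t   ≡⟨ cong (_% t) (trans (cong (_+ k) (+-comm a i)) (trans (+-assoc i a k) (cong (_+_ i) a+k≡t))) ⟩
      (i + t) % t       ≡⟨ [m+n]%n≡m%n i t ⟩
      i % t             ≡⟨ m<n⇒m%n≡m (subst (i <_) a+k≡t (<-≤-trans i<k (m≤n+m k a))) ⟩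
      i                 ∎

  ∑-σ-complementary : ∀ (F : ℕ → ℕ → ℕ) {k} → k ≤ t →
    ∑[ r < t ] F r (σ k r) + ∑[ r < t ] F r (σ (t ∸ k) r)
      ≡ ∑[ i < t ∸ k ] (F i (i + k) + F (i + k) i) + ∑[ i < k ] (F i (i + (t ∸ k)) + F (i + (t ∸ k)) i)
  ∑-σ-complementary F {k} k≤t = begin
    ∑[ r < t ] F r (σ k r) + ∑[ r < t ] F r (σ a r)
      ≡⟨ cong₂ _+_ (∑-σ F (m∸n+n≡m k≤t)) (∑-σ F (trans (+-comm k a) (m∸n+n≡m k≤t))) ⟩
    (∑[ i < a ] F i (i + k) + ∑[ i < k ] F (i + a) i) + (∑[ i < k ] F i (i + a) + ∑[ i < a ] F (i + k) i)
      ≡⟨ regroup (∑[ i < a ] F i (i + k)) (∑[ i < k ] F (i + a) i) (∑[ i < k ] F i (i + a)) (∑[ i < a ] F (i + k) i) ⟩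
    (∑[ i < a ] F i (i + k) + ∑[ i < a ] F (i + k) i) + (∑[ i < k ] F i (i + a) + ∑[ i < k ] F (i + a) i)
      ≡⟨ cong₂ _+_ (∑-distrib-+ a _ _) (∑-distrib-+ k _ _) ⟨
    ∑[ i < a ] (F i (i + k) + F (i + k) i) + ∑[ i < k ] (F i (i + a) + F (i + a) i) ∎
    where
    a = t ∸ k
    regroup : ∀ w x y z → (w + x) + (y + z) ≡ (w + z) + (y + x)
    regroup = solve-∀

triangle-*2 : ∀ n → triangle (suc n) * 2 ≡ suc n * n
triangle-*2 zero    = refl
triangle-*2 (suc n) = begin
  triangle (suc (suc n)) * 2       ≡⟨ cong (_* 2) (∑-last (suc n) (λ b → b)) ⟩
  (triangle (suc n) + suc n) * 2   ≡⟨ *-distribʳ-+ 2 (triangle (suc n)) (suc n) ⟩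
  triangle (suc n) * 2 + suc n * 2 ≡⟨ cong (_+ suc n * 2) (triangle-*2 n) ⟩
  suc n * n + suc n * 2            ≡⟨ expand n ⟩
  suc (suc n) * suc n              ∎
  where
  expand : ∀ n → suc n * n + suc n * 2 ≡ suc (suc n) * suc n
  expand = solve-∀

binom2-+ : ∀ n → binom2 (+ n) ≡ + triangle n
binom2-+ zero    = refl
binom2-+ (suc n) = begin
  (+ suc n ℤ.* + n) ℤ./ℕ 2         ≡⟨ cong (ℤ._/ℕ 2) (ℤ.pos-* (suc n) n) ⟨
  + (suc n * n / 2)               ≡⟨ cong (λ x → + (x / 2)) (triangle-*2 n) ⟨
  + (triangle (suc n) * 2 / 2)    ≡⟨ cong +_ (m*n/n≡m (triangle (suc n)) 2) ⟩
  + triangle (suc n)              ∎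

binom2-[1+] : ∀ n → binom2 -[1+ n ] ≡ + triangle (suc (suc n))
binom2-[1+] n = begin
  (-[1+ n ] ℤ.* (-[1+ n ] ℤ.- + 1)) ℤ./ℕ 2 ≡⟨ cong (λ x → (-[1+ n ] ℤ.* -[1+ suc x ]) ℤ./ℕ 2) (+-identityʳ n) ⟩
  + (suc n * suc (suc n) / 2)
    ≡⟨ cong (λ x → + (x / 2)) (trans (*-comm (suc n) (suc (suc n))) (sym (triangle-*2 (suc n)))) ⟩
  + (triangle (suc (suc n)) * 2 / 2)      ≡⟨ cong +_ (m*n/n≡m (triangle (suc (suc n))) 2) ⟩
  + triangle (suc (suc n))                ∎

triangle-pair : ∀ a b → + (triangle (suc b ∸ a) + triangle (a ∸ b)) ≡ binom2 (a ⊖ b)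
triangle-pair zero    zero    = refl
triangle-pair (suc a) zero    = trans (cong (λ n → + (triangle n + triangle (suc a))) (0∸n≡0 a)) (sym (binom2-+ (suc a)))
triangle-pair zero    (suc b) = trans (cong +_ (+-identityʳ _)) (sym (binom2-[1+] b))
triangle-pair (suc a) (suc b) = trans (triangle-pair a b) (cong binom2 (sym (ℤ.[1+m]⊖[1+n]≡m⊖n a b)))

runnerPairs-binom2 : ∀ D {i j} → i < j → + (runnerPairs D i j + runnerPairs D j i) ≡ binom2 (+ D i ℤ.- + D j)
runnerPairs-binom2 D {i} {j} i<j = begin
  + (runnerPairs D i j + runnerPairs D j i)
    ≡⟨ cong₂ (λ u v → + (u + v)) forward backward ⟩
  + (triangle (suc (D j) ∸ D i) + triangle (D i ∸ D j))
    ≡⟨ triangle-pair (D i) (D j) ⟩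
  binom2 (D i ⊖ D j)
    ≡⟨ cong binom2 (ℤ.[+m]-[+n]≡m⊖n (D i) (D j)) ⟨
  binom2 (+ D i ℤ.- + D j) ∎
  where
  forward : runnerPairs D i j ≡ triangle (suc (D j) ∸ D i)
  forward = begin
    ∑[ b < D j ] ((b + ⟦ i <ᵇ j ⟧) ∸ D i) ≡⟨ ∑-cong (D j) (λ b _ → cong (λ c → (b + ⟦ c ⟧) ∸ D i) (<ᵇ-true i<j)) ⟩
    ∑[ b < D j ] ((b + 1) ∸ D i)          ≡⟨ ∑-cong (D j) (λ b _ → cong (_∸ D i) (+-comm b 1)) ⟩
    0 + ∑[ b < D j ] (suc b ∸ D i)        ≡⟨ cong (_+ ∑[ b < D j ] (suc b ∸ D i)) (0∸n≡0 (D i)) ⟨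
    ∑[ b < suc (D j) ] (b ∸ D i)          ≡⟨ ∑-∸ (suc (D j)) (D i) ⟩
    triangle (suc (D j) ∸ D i)            ∎
  backward : runnerPairs D j i ≡ triangle (D i ∸ D j)
  backward = begin
    ∑[ b < D i ] ((b + ⟦ j <ᵇ i ⟧) ∸ D j) ≡⟨ ∑-cong (D i) (λ b _ → cong (λ c → (b + ⟦ c ⟧) ∸ D j) (<ᵇ-false (<⇒≤ i<j))) ⟩
    ∑[ b < D i ] ((b + 0) ∸ D j)          ≡⟨ ∑-cong (D i) (λ b _ → cong (_∸ D j) (+-identityʳ b)) ⟩
    ∑[ b < D i ] (b ∸ D j)                ≡⟨ ∑-∸ (D i) (D j) ⟩
    triangle (D i ∸ D j)                  ∎

foldr-+-map-applyUpTo : ∀ {A : Set} (F : A → ℤ) (h : ℕ → A) (g : ℕ → ℕ) n (f : ℕ → ℕ) acc →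
  (∀ i → i < n → F (h (f i)) ≡ + g (f i)) →
  foldr ℤ._+_ (+ acc) (map F (map h (applyUpTo f n))) ≡ + (∑[ i < n ] g (f i) + acc)
foldr-+-map-applyUpTo F h g zero    f acc eq = refl
foldr-+-map-applyUpTo F h g (suc n) f acc eq = begin
  F (h (f 0)) ℤ.+ foldr ℤ._+_ (+ acc) (map F (map h (applyUpTo (f ∘ suc) n)))
    ≡⟨ cong₂ ℤ._+_ (eq 0 z<s) (foldr-+-map-applyUpTo F h g n (f ∘ suc) acc (λ i i<n → eq (suc i) (s<s i<n))) ⟩
  + (g (f 0) + (∑[ i < n ] g (f (suc i)) + acc))
    ≡⟨ cong +_ (+-assoc (g (f 0)) _ acc) ⟨
  + (g (f 0) + ∑[ i < n ] g (f (suc i)) + acc) ∎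

sumB-∑ : ∀ {t k} d (g : ℕ → ℕ → ℕ) → 1 ≤ k → k < t →
  (∀ {i j} → i < j → j < t → binom2 (d i ℤ.- d j) ≡ + g i j) →
  sumB t k d ≡ + (∑[ i < t ∸ k ] g i (i + k) + ∑[ i < k ] g i (i + (t ∸ k)))
sumB-∑ {t} {k} d g 1≤k k<t eq = begin
  foldr ℤ._+_ (+ 0) (map F (xs ++ ys))
    ≡⟨ cong (foldr ℤ._+_ (+ 0)) (map-++ F xs ys) ⟩
  foldr ℤ._+_ (+ 0) (map F xs ++ map F ys)
    ≡⟨ foldr-++ ℤ._+_ (+ 0) (map F xs) (map F ys) ⟩
  foldr ℤ._+_ (foldr ℤ._+_ (+ 0) (map F ys)) (map F xs)
    ≡⟨ cong (λ acc → foldr ℤ._+_ acc (map F xs))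
            (foldr-+-map-applyUpTo F _ (λ i → g i (i + a)) k id 0 (λ i i<k → eq (m<m+n i 0<a) (wrapped i<k))) ⟩
  foldr ℤ._+_ (+ (∑[ i < k ] g i (i + a) + 0)) (map F xs)
    ≡⟨ foldr-+-map-applyUpTo F _ (λ i → g i (i + k)) a id _ (λ i i<a → eq (m<m+n i 1≤k) (unwrapped i<a)) ⟩
  + (∑[ i < a ] g i (i + k) + (∑[ i < k ] g i (i + a) + 0))
    ≡⟨ cong (λ x → + (∑[ i < a ] g i (i + k) + x)) (+-identityʳ _) ⟩
  + (∑[ i < a ] g i (i + k) + ∑[ i < k ] g i (i + a)) ∎
  where
  a = t ∸ k
  xs = map (λ i → i , i + k) (upTo a)
  ys = map (λ i → i , i + a) (upTo k)
  F : ℕ × ℕ → ℤ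
  F p = binom2 (d (proj₁ p) ℤ.- d (proj₂ p))
  0<a : 0 < a
  0<a = m<n⇒0<n∸m k<t
  unwrapped : ∀ {i} → i < a → i + k < t
  unwrapped {i} i<a = subst (i + k <_) (m∸n+n≡m (<⇒≤ k<t)) (+-monoˡ-< k i<a)
  wrapped : ∀ {i} → i < k → i + a < t
  wrapped {i} i<k = subst (i + a <_) (m+[n∸m]≡n (<⇒≤ k<t)) (+-monoˡ-< a i<k)

-- The abacus of a t-core

hookClassSize-core : ∀ {t} .{{_ : NonZero t}} μ → IsCore t μ → hookClassSize t μ 0 ≡ 0
hookClassSize-core {t} μ core =
  cong length (filter-none (λ h → h % t ≟ 0) (All.map (λ ¬t∣h h%t≡0 → ¬t∣h (m%n≡0⇒n∣m _ t h%t≡0)) core))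

lookupℤ : List Bool → ℤ → Bool
lookupℤ u (+ n)    = lookupOr1 u n
lookupℤ u -[1+ _ ] = false

z≡lookupℤ : ∀ μ j → z μ j ≡ lookupℤ (boundaryWord μ) (j ℤ.+ + length μ)
z≡lookupℤ μ j with j ℤ.+ + length μ
... | + n      = refl
... | -[1+ n ] = refl

lookupℤ-⊖ : ∀ P u n → lookupℤ u (n ⊖ P) ≡ lookupOr1 (replicate P false ++ u) n
lookupℤ-⊖ zero    u n       = refl
lookupℤ-⊖ (suc P) u zero    = refl
lookupℤ-⊖ (suc P) u (suc n) = trans (cong (lookupℤ u) (ℤ.[1+m]⊖[1+n]≡m⊖n n P)) (lookupℤ-⊖ P u n)

lookupOr1-beyond : ∀ u {n} → length u ≤ n → lookupOr1 u n ≡ true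
lookupOr1-beyond []      _         = refl
lookupOr1-beyond (b ∷ u) (s≤s u≤n) = lookupOr1-beyond u u≤n

pairCountWord-padding : ∀ P u R → pairCountWord (replicate P false ++ u) R ≡ pairCountWord u R
pairCountWord-padding zero    u R = refl
pairCountWord-padding (suc P) u R = pairCountWord-padding P u R

pairCount≡0 : ∀ {L Z R} → pairCount L Z R ≡ 0 →
  ∀ {p q} → p < q → q < L → Z p ≡ true → R (q ∸ p) ≡ true → Z q ≡ true
pairCount≡0 {L} {Z} {R} none {p} {q} p<q q<L Zp Rqp with Z q in Zq
... | true  = refl
... | false = contradiction (subst (λ b → ⟦ b ⟧ ≡ 0) (cong₂ _∧_ Zp Rqp) (∑≡0⇒≡0 q _ column p p<q)) 1+n≢0
  where
  column : onesBefore Z q R ≡ 0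
  column = trans (cong (λ b → if b then 0 else onesBefore Z q R) (sym Zq)) (∑≡0⇒≡0 L _ none q q<L)

pairCount-extend : ∀ {L₁ L₂} Z R → L₁ ≤ L₂ → (∀ {q} → L₁ ≤ q → Z q ≡ true) →
  pairCount L₂ Z R ≡ pairCount L₁ Z R
pairCount-extend Z R L₁≤L₂ full = ∑-truncate column column L₁≤L₂ (λ _ _ → refl)
  (λ q L₁≤q → cong (λ b → if b then 0 else onesBefore Z q R) (full L₁≤q))
  where
  column : ℕ → ℕ
  column q = if Z q then 0 else onesBefore Z q R

m≡[m+n]-n : ∀ (a b : ℤ) → a ≡ (a ℤ.+ b) ℤ.- b
m≡[m+n]-n = ℤ.solve-∀

module CoreAbacus (t′ : ℕ) {μ : List ℕ} (dec : Decreasing μ) (core : IsCore (suc t′) μ)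
                  (d : ℕ → ℤ) (isD : ∀ i → i < suc t′ → IsD (suc t′) μ i (d i)) where

  open Runners (suc t′) public

  private
    t = suc t′
    ℓ = length μ
    P = t′ * ℓ
    word = replicate P false ++ boundaryWord μ
    L = length word

  -- Padding with P = tℓ − ℓ zeros puts z_{n − tℓ} at position n, so that positions and
  -- indices of z agree mod t.
  Z : ℕ → Bool
  Z = lookupOr1 word

  z≡Z : ∀ e s → z μ (+ t ℤ.* (+ e ℤ.- + ℓ) ℤ.+ + s) ≡ Z (e * t + s)
  z≡Z e s = begin
    z μ (+ t ℤ.* (+ e ℤ.- + ℓ) ℤ.+ + s)
      ≡⟨ z≡lookupℤ μ (+ t ℤ.* (+ e ℤ.- + ℓ) ℤ.+ + s) ⟩
    lookupℤ (boundaryWord μ) ((+ t ℤ.* (+ e ℤ.- + ℓ) ℤ.+ + s) ℤ.+ + ℓ)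
      ≡⟨ cong (lookupℤ (boundaryWord μ)) position ⟩
    lookupℤ (boundaryWord μ) ((e * t + s) ⊖ P)
      ≡⟨ lookupℤ-⊖ P (boundaryWord μ) (e * t + s) ⟩
    Z (e * t + s) ∎
    where
    shift : ∀ (T′ E S L : ℤ) →
      ((ℤ.+ 1 ℤ.+ T′) ℤ.* (E ℤ.- L) ℤ.+ S) ℤ.+ L ≡ (E ℤ.* (ℤ.+ 1 ℤ.+ T′) ℤ.+ S) ℤ.- T′ ℤ.* L
    shift = ℤ.solve-∀
    position : (+ t ℤ.* (+ e ℤ.- + ℓ) ℤ.+ + s) ℤ.+ + ℓ ≡ (e * t + s) ⊖ P
    position = trans (shift (+ t′) (+ e) (+ s) (+ ℓ))
      (trans (cong₂ (λ a b → (a ℤ.+ + s) ℤ.- b) (sym (ℤ.pos-* e t)) (sym (ℤ.pos-* t′ ℓ))) (ℤ.[+m]-[+n]≡m⊖n _ P))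

  hookClassSize≡pairCount : ∀ k → hookClassSize t μ k ≡ pairCount L Z (λ h → h % t ≡ᵇ k)
  hookClassSize≡pairCount k = trans (length-filter≡count (λ h → h % t ≟ k) (hooks μ))
    (trans (hooks-pairCount dec R) (sym (pairCountWord-padding P (boundaryWord μ) R)))
    where R = λ h → h % t ≡ᵇ k

  Z-beyond : ∀ {q} → L ≤ q → Z q ≡ true
  Z-beyond = lookupOr1-beyond word

  noHookOfLengthT : pairCount L Z (λ h → h % t ≡ᵇ 0) ≡ 0
  noHookOfLengthT = trans (sym (hookClassSize≡pairCount 0)) (hookClassSize-core μ core)

  -- A 1 at p followed by a 0 at p + t would be a hook of length t.
  Z-+t : ∀ {p} → Z p ≡ true → Z (p + t) ≡ true
  Z-+t {p} Zp with p + t <? L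
  ... | no  p+t≮L = Z-beyond (≮⇒≥ p+t≮L)
  ... | yes p+t<L = pairCount≡0 {L} {Z} {λ h → h % t ≡ᵇ 0} noHookOfLengthT (m<m+n p z<s) p+t<L Zp
                      (trans (cong (λ h → h % t ≡ᵇ 0) (m+n∸m≡n p t)) (cong (_≡ᵇ 0) (n%n≡0 t)))

  -- Otherwise b_i = t d_i + i would lie on the vertical ray.
  d+ℓ-nonnegative : ∀ {i} → i < t → ∀ x → d i ℤ.+ + ℓ ≢ -[1+ x ]
  d+ℓ-nonnegative {i} i<t x eq with m≤n⇒∃[o]m+o≡n i<t
  ... | r , 1+i+r≡t = contradiction (trans (sym (proj₁ (isD i i<t))) z≡false) λ ()
    where
    t′≡i+r : t′ ≡ i + r
    t′≡i+r = sym (suc-injective 1+i+r≡t)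
    expand : ∀ (X L I R : ℤ) → ((ℤ.+ 1 ℤ.+ (I ℤ.+ R)) ℤ.* ((ℤ.- (ℤ.+ 1 ℤ.+ X)) ℤ.- L) ℤ.+ I) ℤ.+ L
          ≡ ℤ.- (ℤ.+ 1 ℤ.+ (R ℤ.+ (ℤ.+ 1 ℤ.+ (I ℤ.+ R)) ℤ.* X ℤ.+ (I ℤ.+ R) ℤ.* L))
    expand = ℤ.solve-∀
    position : (+ t ℤ.* d i ℤ.+ + i) ℤ.+ + ℓ ≡ -[1+ r + t * x + t′ * ℓ ]
    position = begin
      (+ t ℤ.* d i ℤ.+ + i) ℤ.+ + ℓ
        ≡⟨ cong₂ (λ T D → (T ℤ.* D ℤ.+ + i) ℤ.+ + ℓ) (cong (λ n → + suc n) t′≡i+r)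
                 (trans (m≡[m+n]-n (d i) (+ ℓ)) (cong (ℤ._- + ℓ) eq)) ⟩
      (+ suc (i + r) ℤ.* (-[1+ x ] ℤ.- + ℓ) ℤ.+ + i) ℤ.+ + ℓ
        ≡⟨ expand (+ x) (+ ℓ) (+ i) (+ r) ⟩
      ℤ.- (ℤ.+ 1 ℤ.+ (+ r ℤ.+ + suc (i + r) ℤ.* + x ℤ.+ + (i + r) ℤ.* + ℓ))
        ≡⟨ cong₂ (λ a b → ℤ.- (ℤ.+ 1 ℤ.+ (+ r ℤ.+ a ℤ.+ b)))
                 (trans (sym (ℤ.pos-* (suc (i + r)) x)) (cong (λ n → + (suc n * x)) (sym t′≡i+r)))
                 (trans (sym (ℤ.pos-* (i + r) ℓ)) (cong (λ n → + (n * ℓ)) (sym t′≡i+r))) ⟩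
      -[1+ r + t * x + t′ * ℓ ] ∎
    z≡false : z μ (+ t ℤ.* d i ℤ.+ + i) ≡ false
    z≡false = trans (z≡lookupℤ μ (+ t ℤ.* d i ℤ.+ + i)) (cong (lookupℤ (boundaryWord μ)) position)

  D : ℕ → ℕ
  D i = ℤ.∣ d i ℤ.+ + ℓ ∣

  d≡D-ℓ : ∀ {i} → i < t → d i ≡ + D i ℤ.- + ℓ
  d≡D-ℓ {i} i<t with d i ℤ.+ + ℓ in eq
  ... | + n      = trans (m≡[m+n]-n (d i) (+ ℓ)) (cong (ℤ._- + ℓ) eq)
  ... | -[1+ x ] = contradiction eq (d+ℓ-nonnegative i<t x)

  Z-+t* : ∀ {p} x → Z p ≡ true → Z (p + x * t) ≡ true
  Z-+t* {p} zero    Zp = subst (λ q → Z q ≡ true) (sym (+-identityʳ p)) Zp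
  Z-+t* {p} (suc x) Zp = subst (λ q → Z q ≡ true) (trans (+-assoc p (x * t) t) (cong (_+_ p) (+-comm (x * t) t)))
                               (Z-+t (Z-+t* x Zp))

  Z-at-D : ∀ {s} → s < t → Z (D s * t + s) ≡ true
  Z-at-D {s} s<t = trans (sym (z≡Z (D s) s))
                         (subst (λ y → z μ (+ t ℤ.* y ℤ.+ + s) ≡ true) (d≡D-ℓ s<t) (proj₁ (isD s s<t)))

  Z-below-D : ∀ {s e} → s < t → e < D s → Z (e * t + s) ≡ false
  Z-below-D {s} {e} s<t e<D = trans (sym (z≡Z e s)) (proj₂ (isD s s<t) (+ e ℤ.- + ℓ) e-ℓ<d)
    where
    e-ℓ<d : + e ℤ.- + ℓ ℤ.< d s
    e-ℓ<d = subst (+ e ℤ.- + ℓ ℤ.<_) (sym (d≡D-ℓ s<t)) (ℤ.+-monoˡ-< (ℤ.- + ℓ) (ℤ.+<+ e<D))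

  Z-runner : ∀ b s → s < t → Z (b * t + s) ≡ (D s ≤ᵇ b)
  Z-runner b s s<t with D s ≤? b
  ... | no  D≰b = trans (Z-below-D s<t (≰⇒> D≰b)) (sym (≤ᵇ-false (≰⇒> D≰b)))
  ... | yes D≤b with m≤n⇒∃[o]m+o≡n D≤b
  ...   | x , refl = trans (cong Z (regroup (D s) x s t)) (trans (Z-+t* x (Z-at-D s<t)) (sym (≤ᵇ-true D≤b)))
    where
    regroup : ∀ a x s t → (a + x) * t + s ≡ a * t + s + x * t
    regroup = solve-∀

  D≤L : ∀ s → s < t → D s ≤ L
  D≤L s s<t with D s ≤? L
  ... | yes D≤L = D≤L
  ... | no  D≰L = contradiction (trans (sym (Z-beyond L≤Lt+s)) (Z-below-D s<t (≰⇒> D≰L))) λ ()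
    where L≤Lt+s = ≤-trans (m≤m*n L t) (m≤m+n (L * t) s)

  hookClassSize-runners : ∀ {k} → k < t → hookClassSize t μ k ≡ ∑[ r < t ] runnerPairs D r (σ k r)
  hookClassSize-runners {k} k<t = begin
    hookClassSize t μ k                ≡⟨ hookClassSize≡pairCount k ⟩
    pairCount L Z R                    ≡⟨ pairCount-extend Z R (m≤m*n L t) Z-beyond ⟨
    pairCount (L * t) Z R              ≡⟨ pairCount-runners D Z Z-runner k<t L D≤L ⟩
    ∑[ r < t ] runnerPairs D r (σ k r) ∎
    where
    R : ℕ → Bool
    R h = h % t ≡ᵇ k

  binom2-d : ∀ {i j} → i < j → j < t → binom2 (d i ℤ.- d j) ≡ + (runnerPairs D i j + runnerPairs D j i)
  binom2-d {i} {j} i<j j<t = begin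
    binom2 (d i ℤ.- d j)                               ≡⟨ cong binom2 (cong₂ ℤ._-_ (d≡D-ℓ (<-trans i<j j<t)) (d≡D-ℓ j<t)) ⟩
    binom2 ((+ D i ℤ.- + ℓ) ℤ.- (+ D j ℤ.- + ℓ))        ≡⟨ cong binom2 (cancel (+ D i) (+ D j) (+ ℓ)) ⟩
    binom2 (+ D i ℤ.- + D j)                           ≡⟨ runnerPairs-binom2 D i<j ⟨
    + (runnerPairs D i j + runnerPairs D j i)          ∎
    where
    cancel : ∀ (a b l : ℤ) → (a ℤ.- l) ℤ.- (b ℤ.- l) ≡ a ℤ.- b
    cancel = ℤ.solve-∀

lemma4p2 : (t : ℕ) .{{_ : NonZero t}} (μ : List ℕ) → IsPartition μ → IsCore t μ →
    (d : ℕ → ℤ) → (∀ i → i < t → IsD t μ i (d i)) →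
    (k : ℕ) → 1 ≤ k → k < t →
    (hookClassSize t μ 0 ≡ 0) ×
    (+ (hookClassSize t μ k + hookClassSize t μ (t ∸ k)) ≡ sumB t k d)
lemma4p2 t@(suc t′) μ (dec , _) core d isD k 1≤k k<t = hookClassSize-core μ core , (begin
  + (hookClassSize t μ k + hookClassSize t μ (t ∸ k))
    ≡⟨ cong₂ (λ u v → + (u + v)) (hookClassSize-runners k<t) (hookClassSize-runners (∸-monoʳ-< 1≤k (<⇒≤ k<t))) ⟩
  + (∑[ r < t ] runnerPairs D r (σ k r) + ∑[ r < t ] runnerPairs D r (σ (t ∸ k) r))
    ≡⟨ cong +_ (∑-σ-complementary (runnerPairs D) (<⇒≤ k<t)) ⟩
  + (∑[ i < t ∸ k ] (runnerPairs D i (i + k) + runnerPairs D (i + k) i)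
     + ∑[ i < k ] (runnerPairs D i (i + (t ∸ k)) + runnerPairs D (i + (t ∸ k)) i))
    ≡⟨ sumB-∑ d (λ i j → runnerPairs D i j + runnerPairs D j i) 1≤k k<t binom2-d ⟨
  sumB t k d ∎)
  where open CoreAbacus t′ dec core d isD
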